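{- Let $u$ and $w$ be two pin words and let $u=u^{(1)}\cdots u^{(j)}$ be the strong numeral-led factor decomposition of $u$. Then $u\preccurlyeq w$ if and only if $w$ can be written as a concatenation $w=v^{(1)}w^{(1)}\cdots v^{(j)}w^{(j)}v^{(j+1)}$ (the $v^{(i)}$ possibly empty) such that for all $i\in\{1,\dots,j\}$, $w^{(i)}\in\mathcal{SP}\cup\mathcal{M}$ and $\phi(w^{(i)})$ has a factor in $\phi(u^{(i)})$.
   Context: Pin words: given a pin sequence representation $(p_1,\dots,p_n)$ of a permutation (a sequence of points, no two on a common horizontal or vertical line, each $p_i$, $i\ge2$, outside the bounding box of the previous ones and either separating $p_{i-1}$ from $\{p_1,\dots,p_{i-2}\}$ by a horizontal or vertical line, or separating no two nonempty subsets of the previous points; order-isomorphic to the diagram of the permutation) and an origin point $p_0$ such that $(p_0,\dots,p_n)$ is still such a sequence, each $p_i$ ($i\ge1$) is encoded by $U$ (resp. $D,L,R$) if $p_i$ separates $p_{i-1}$ from $\{p_0,\dots,p_{i-2}\}$ from the top (resp. bottom, left, right), and by $1$ (resp. $2,3,4$) if $p_i$ separates no two nonempty subsets of $\{p_0,\dots,p_{i-1}\}$ and lies up-right (resp. up-left, bottom-left, bottom-right) of the bounding box of $\{p_0,\dots,p_{i-1}\}$. The resulting word is a pin word. $U,D,L,R$ are directions and $1,2,3,4$ numerals. $\mathcal{SP}$ is the set of strict pin words (a numeral followed only by directions). Every pin word starts with a numeral; cutting it before each numeral gives its strong numeral-led factor decomposition, whose factors are strict pin words. The order $\preccurlyeq$: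 for pin words $u=u^{(1)}\cdots u^{(j)}$ (strong numeral-led decomposition) and $w$, $u\preccurlyeq w$ iff $w=v^{(1)}w^{(1)}\cdots v^{(j)}w^{(j)}v^{(j+1)}$ with, for all $i$: if $w^{(i)}$ begins with a numeral then $w^{(i)}=u^{(i)}$; if $w^{(i)}$ begins with a direction then $v^{(i)}$ is nonempty, the point encoded by the first letter of $w^{(i)}$ lies in the quadrant with respect to the origin $p_0$ of the encoding $w$ given by the first letter of $u^{(i)}$ (quadrant $1,2,3,4$ = up-right, up-left, bottom-left, bottom-right of $p_0$), and all other letters of $u^{(i)}$ and $w^{(i)}$ agree. $\mathcal{M}$: words of length at least $2$ over $\{U,D,L,R\}$ in which letters of $\{L,R\}$ and of $\{U,D\}$ alternate. The map $\phi$ is the identity on $\mathcal{M}$; on a strict pin word $u=u'u''$ with $|u'|=2$, $\phi(u)=\varphi(u')u''$ where $\varphi$: $1R\mapsto RUR$, $1L\mapsto RUL$, $1U\mapsto URU$, $1D\mapsto URD$, $2R\mapsto LUR$, $2L\mapsto LUL$, $2U\mapsto ULU$, $2D\mapsto ULD$, $3R\mapsto LDR$, $3L\mapsto LDL$, $3U\mapsto DLU$, $3D\mapsto DLD$, $4R\mapsto RDR$, $4L\mapsto RDL$, $4U\mapsto DRU$, $4D\mapsto DRD$; on single numerals $\phi(1)=\{UR,RU\}$, $\phi(2)=\{UL,LU\}$, $\phi(3)=\{DL,LD\}$, $\phi(4)=\{RD,DR\}$. "$\phi(x)$ has a factor in $\phi(u)$" means: if $|u|=1$, $\phi(x)$ has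 a factor in the two-element set $\phi(u)$; if $|u|\ge2$, the word $\phi(u)$ is a factor of $\phi(x)$. -}

module Defs where

open import Data.List using (List; []; _∷_; _++_; map; concat; length)
open import Data.List.Relation.Unary.All using (All)
open import Data.Maybe using (Maybe; just; nothing)
open import Data.Nat using (ℕ; _≥_)
open import Data.Product using (Σ; _×_; _,_)
open import Data.Sum using (_⊎_)
open import Data.Empty using (⊥)
open import Data.Unit using (⊤)
open import Relation.Nullary using (¬_)
open import Relation.Binary.PropositionalEquality using (_≡_)

-- Quadrants / numerals: q1 = up-right, q2 = up-left, q3 = bottom-left, q4 = bottom-right
data Quadrant : Set where
  q1 q2 q3 q4 : Quadrant

data Dir : Set where
  U D L R : Dir

data Letter : Set where
  num : Quadrant → Letter
  dir : Dir → Letter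

Word : Set
Word = List Letter

data Orientation : Set where
  vert horiz : Orientation

orient : Dir → Orientation
orient U = vert
orient D = vert
orient L = horiz
orient R = horiz

IsDir : Letter → Set
IsDir (num _) = ⊥
IsDir (dir _) = ⊤

-- Pin words: a point encoded by U/D separates the previous point by a
-- horizontal line, so the previous point must not itself be U/D (it would
-- lie horizontally inside the bounding box); likewise for L/R.

AdjOK : Letter → Letter → Set
AdjOK (dir d) (dir e) = ¬ (orient d ≡ orient e)
AdjOK _ _ = ⊤

Chain : Letter → Word → Set
Chain x [] = ⊤
Chain x (y ∷ ys) = AdjOK x y × Chain y ys

PinWord : Word → Set
PinWord [] = ⊥
PinWord (num q ∷ rest) = Chain (num q) rest
PinWord (dir _ ∷ _) = ⊥

StrictShape : Word → Set
StrictShape [] = ⊥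
StrictShape (num q ∷ rest) = All IsDir rest
StrictShape (dir _ ∷ _) = ⊥

SP : Word → Set
SP w = PinWord w × StrictShape w

M : Word → Set
M [] = ⊥
M (num _ ∷ _) = ⊥
M (dir d ∷ []) = ⊥
M (dir d ∷ rest@(_ ∷ _)) = Chain (dir d) rest × All IsDir rest

StrongDecomp : Word → List Word → Set
StrongDecomp u us = (concat us ≡ u) × All StrictShape us

-- Quadrant (w.r.t. the origin p₀) of the last point of an encoding.
-- Numeral q: the point is beyond the bounding box in direction q, hence in
-- quadrant q of p₀.  Direction U: the point is above everything and lies
-- horizontally between the previous point and the bounding box of the
-- earlier ones, hence on the same horizontal side of p₀ as the previous
-- point (similarly D, L, R).

data VSide : Set where
  up down : VSide

data HSide : Set where
  left right : HSide

vside : Quadrant → VSide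
vside q1 = up
vside q2 = up
vside q3 = down
vside q4 = down

hside : Quadrant → HSide
hside q1 = right
hside q2 = left
hside q3 = left
hside q4 = right

mkQ : VSide → HSide → Quadrant
mkQ up right = q1
mkQ up left = q2
mkQ down left = q3
mkQ down right = q4

stepQ : Dir → Quadrant → Quadrant
stepQ U q = mkQ up (hside q)
stepQ D q = mkQ down (hside q)
stepQ L q = mkQ (vside q) left
stepQ R q = mkQ (vside q) right

lastQuadFrom : Maybe Quadrant → Word → Maybe Quadrant
lastQuadFrom acc [] = acc
lastQuadFrom acc (num q ∷ xs) = lastQuadFrom (just q) xs
lastQuadFrom (just q) (dir d ∷ xs) = lastQuadFrom (just (stepQ d q)) xs
lastQuadFrom nothing (dir d ∷ xs) = lastQuadFrom nothing xs

lastQuad : Word → Maybe Quadrant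
lastQuad = lastQuadFrom nothing

-- Decompositions w = v¹ w¹ ⋯ vʲ wʲ vʲ⁺¹ subject to a condition
-- C pre vᵢ uᵢ wᵢ, where pre = v¹ w¹ ⋯ vⁱ⁻¹ wⁱ⁻¹ is the prefix of w before vᵢ.

data Split (C : Word → Word → Word → Word → Set) : Word → List Word → Word → Set where
  end  : ∀ {pre} (w : Word) → Split C pre [] w
  step : ∀ {pre u us w} (v wi rest : Word) →
         w ≡ v ++ wi ++ rest →
         C pre v u wi →
         Split C (pre ++ v ++ wi) us rest →
         Split C pre (u ∷ us) w

Cprec : Word → Word → Word → Word → Set
Cprec pre v u wi =
  (Σ Quadrant λ q → Σ Word λ t → (wi ≡ num q ∷ t) × (wi ≡ u))
  ⊎
  (Σ Dir λ d → Σ Word λ t → Σ Quadrant λ q → Σ Word λ t' →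
     (wi ≡ dir d ∷ t) × (u ≡ num q ∷ t') × ¬ (v ≡ []) ×
     (lastQuad (pre ++ v ++ dir d ∷ []) ≡ just q) × (t ≡ t'))

_≼_ : Word → Word → Set
u ≼ w = Σ (List Word) λ us → StrongDecomp u us × Split Cprec [] us w

dirs : List Dir → Word
dirs = map dir

varphi : Quadrant → Dir → List Dir
varphi q1 R = R ∷ U ∷ R ∷ []
varphi q1 L = R ∷ U ∷ L ∷ []
varphi q1 U = U ∷ R ∷ U ∷ []
varphi q1 D = U ∷ R ∷ D ∷ []
varphi q2 R = L ∷ U ∷ R ∷ []
varphi q2 L = L ∷ U ∷ L ∷ []
varphi q2 U = U ∷ L ∷ U ∷ []
varphi q2 D = U ∷ L ∷ D ∷ []
varphi q3 R = L ∷ D ∷ R ∷ []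
varphi q3 L = L ∷ D ∷ L ∷ []
varphi q3 U = D ∷ L ∷ U ∷ []
varphi q3 D = D ∷ L ∷ D ∷ []
varphi q4 R = R ∷ D ∷ R ∷ []
varphi q4 L = R ∷ D ∷ L ∷ []
varphi q4 U = D ∷ R ∷ U ∷ []
varphi q4 D = D ∷ R ∷ D ∷ []

phiPair : Quadrant → List Dir × List Dir
phiPair q1 = (U ∷ R ∷ []) , (R ∷ U ∷ [])
phiPair q2 = (U ∷ L ∷ []) , (L ∷ U ∷ [])
phiPair q3 = (D ∷ L ∷ []) , (L ∷ D ∷ [])
phiPair q4 = (R ∷ D ∷ []) , (D ∷ R ∷ [])

phi : Word → Word
phi (num q ∷ dir d ∷ rest) = dirs (varphi q d) ++ rest
phi w = w

-- y ∈ φ(w) (φ(w) seen as a set: two elements for a single numeral,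
-- a singleton otherwise)
PhiElem : Word → Word → Set
PhiElem (num q ∷ []) y with phiPair q
... | a , b = (y ≡ dirs a) ⊎ (y ≡ dirs b)
PhiElem w y = y ≡ phi w

Factor : Word → Word → Set
Factor x y = Σ Word λ a → Σ Word λ b → y ≡ a ++ x ++ b

HasFactorIn : Word → Word → Set
HasFactorIn w u = Σ Word λ y → Σ Word λ x → PhiElem w y × PhiElem u x × Factor x y

Cphi : Word → Word → Word → Word → Set
Cphi pre v u wi = (SP wi ⊎ M wi) × HasFactorIn wi u

-- Two consecutive pins whose directions c, d are perpendicular (a turn c ⟂ d) put the second pin in
-- a quadrant `corner` of the origin that does not depend on anything before c, and φ of a strict pin
-- word q t consists exactly of the words c d t for the turns c d into quadrant q (d perpendicular to
-- the first letter of t).  Hence a direction-led block d t of w whose pin lies in quadrant q becomes,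
-- together with the letter before it, a block of SP ∪ M whose image under φ contains φ(q t);
-- conversely an occurrence of φ(q t) in φ(wⁱ) either shows that wⁱ starts with q t or locates such a
-- pin d inside wⁱ.  Each kind of decomposition of w is thus recut block by block into the other, the
-- leftover letters of a block moving into the gap before the next one.  Strong numeral-led
-- decompositions are unique, so the decomposition hidden in u ≼ w is the given one.

module Submission where

open import Defs
open import Data.List using (List; []; _∷_; _++_; [_]; _∷ʳ_; concat; initLast; _∷ʳ′_)
open import Data.List.Properties
  using (++-assoc; ++-identityʳ; ++-conicalʳ; ∷-injective; ∷ʳ-++; ++-monoid)
open import Data.List.Relation.Unary.All using (All; []; _∷_)
open import Data.Maybe using (just; nothing)
open import Data.Product using (Σ; ∃; ∃₂; _×_; _,_; proj₁; proj₂)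
open import Data.Sum using (_⊎_; inj₁; inj₂)
open import Data.Empty using (⊥; ⊥-elim)
open import Data.Unit using (⊤; tt)
open import Function.Bundles using (_⇔_; mk⇔)
open import Relation.Nullary.Irrelevant using (Irrelevant)
open import Tactic.MonoidSolver using (solve)
open import Relation.Binary.PropositionalEquality
  using (_≡_; _≢_; refl; sym; trans; cong; subst; module ≡-Reasoning)

infix 4 _⟂_

data _⟂_ : Dir → Dir → Set where
  U⟂L : U ⟂ L
  U⟂R : U ⟂ R
  D⟂L : D ⟂ L
  D⟂R : D ⟂ R
  L⟂U : L ⟂ U
  L⟂D : L ⟂ D
  R⟂U : R ⟂ U
  R⟂D : R ⟂ D

⟂-irrelevant : ∀ {c d} → Irrelevant (c ⟂ d)
⟂-irrelevant U⟂L U⟂L = refl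
⟂-irrelevant U⟂R U⟂R = refl
⟂-irrelevant D⟂L D⟂L = refl
⟂-irrelevant D⟂R D⟂R = refl
⟂-irrelevant L⟂U L⟂U = refl
⟂-irrelevant L⟂D L⟂D = refl
⟂-irrelevant R⟂U R⟂U = refl
⟂-irrelevant R⟂D R⟂D = refl

orient≢⇒⟂ : ∀ {c d} → orient c ≢ orient d → c ⟂ d
orient≢⇒⟂ {U} {L} _ = U⟂L
orient≢⇒⟂ {U} {R} _ = U⟂R
orient≢⇒⟂ {D} {L} _ = D⟂L
orient≢⇒⟂ {D} {R} _ = D⟂R
orient≢⇒⟂ {L} {U} _ = L⟂U
orient≢⇒⟂ {L} {D} _ = L⟂D
orient≢⇒⟂ {R} {U} _ = R⟂U
orient≢⇒⟂ {R} {D} _ = R⟂D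
orient≢⇒⟂ {U} {U} c≁d = ⊥-elim (c≁d refl)
orient≢⇒⟂ {U} {D} c≁d = ⊥-elim (c≁d refl)
orient≢⇒⟂ {D} {U} c≁d = ⊥-elim (c≁d refl)
orient≢⇒⟂ {D} {D} c≁d = ⊥-elim (c≁d refl)
orient≢⇒⟂ {L} {L} c≁d = ⊥-elim (c≁d refl)
orient≢⇒⟂ {L} {R} c≁d = ⊥-elim (c≁d refl)
orient≢⇒⟂ {R} {L} c≁d = ⊥-elim (c≁d refl)
orient≢⇒⟂ {R} {R} c≁d = ⊥-elim (c≁d refl)

corner : ∀ {c d} → c ⟂ d → Quadrant
corner U⟂L = q2
corner U⟂R = q1
corner D⟂L = q3
corner D⟂R = q4
corner L⟂U = q2
corner L⟂D = q3
corner R⟂U = q1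
corner R⟂D = q4

stepQ∘stepQ-⟂ : ∀ {c d} (p : c ⟂ d) q → stepQ d (stepQ c q) ≡ corner p
stepQ∘stepQ-⟂ U⟂L = λ { q1 → refl ; q2 → refl ; q3 → refl ; q4 → refl }
stepQ∘stepQ-⟂ U⟂R = λ { q1 → refl ; q2 → refl ; q3 → refl ; q4 → refl }
stepQ∘stepQ-⟂ D⟂L = λ { q1 → refl ; q2 → refl ; q3 → refl ; q4 → refl }
stepQ∘stepQ-⟂ D⟂R = λ { q1 → refl ; q2 → refl ; q3 → refl ; q4 → refl }
stepQ∘stepQ-⟂ L⟂U = λ { q1 → refl ; q2 → refl ; q3 → refl ; q4 → refl }
stepQ∘stepQ-⟂ L⟂D = λ { q1 → refl ; q2 → refl ; q3 → refl ; q4 → refl }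
stepQ∘stepQ-⟂ R⟂U = λ { q1 → refl ; q2 → refl ; q3 → refl ; q4 → refl }
stepQ∘stepQ-⟂ R⟂D = λ { q1 → refl ; q2 → refl ; q3 → refl ; q4 → refl }

stepQ-corner : ∀ {b c d} (p : b ⟂ c) (p′ : c ⟂ d) → stepQ d (corner p) ≡ corner p′
stepQ-corner {b} {c} {d} p p′ = begin
  stepQ d (corner p)              ≡⟨ cong (stepQ d) (sym (stepQ∘stepQ-⟂ p q1)) ⟩
  stepQ d (stepQ c (stepQ b q1))  ≡⟨ stepQ∘stepQ-⟂ p′ _ ⟩
  corner p′                       ∎
  where open ≡-Reasoning

turn-into : ∀ q e → ∃₂ λ c d → Σ (c ⟂ d) λ p → d ⟂ e × corner p ≡ q
turn-into q1 U = _ , _ , U⟂R , R⟂U , refl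
turn-into q1 D = _ , _ , U⟂R , R⟂D , refl
turn-into q1 L = _ , _ , R⟂U , U⟂L , refl
turn-into q1 R = _ , _ , R⟂U , U⟂R , refl
turn-into q2 U = _ , _ , U⟂L , L⟂U , refl
turn-into q2 D = _ , _ , U⟂L , L⟂D , refl
turn-into q2 L = _ , _ , L⟂U , U⟂L , refl
turn-into q2 R = _ , _ , L⟂U , U⟂R , refl
turn-into q3 U = _ , _ , D⟂L , L⟂U , refl
turn-into q3 D = _ , _ , D⟂L , L⟂D , refl
turn-into q3 L = _ , _ , L⟂D , D⟂L , refl
turn-into q3 R = _ , _ , L⟂D , D⟂R , refl
turn-into q4 U = _ , _ , D⟂R , R⟂U , refl
turn-into q4 D = _ , _ , D⟂R , R⟂D , refl
turn-into q4 L = _ , _ , R⟂D , D⟂L , refl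
turn-into q4 R = _ , _ , R⟂D , D⟂R , refl

varphi-corner : ∀ {c d e} (p : c ⟂ d) → d ⟂ e → varphi (corner p) e ≡ c ∷ d ∷ e ∷ []
varphi-corner U⟂L L⟂U = refl
varphi-corner U⟂L L⟂D = refl
varphi-corner U⟂R R⟂U = refl
varphi-corner U⟂R R⟂D = refl
varphi-corner D⟂L L⟂U = refl
varphi-corner D⟂L L⟂D = refl
varphi-corner D⟂R R⟂U = refl
varphi-corner D⟂R R⟂D = refl
varphi-corner L⟂U U⟂L = refl
varphi-corner L⟂U U⟂R = refl
varphi-corner L⟂D D⟂L = refl
varphi-corner L⟂D D⟂R = refl
varphi-corner R⟂U U⟂L = refl
varphi-corner R⟂U U⟂R = refl
varphi-corner R⟂D D⟂L = refl
varphi-corner R⟂D D⟂R = refl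

φ-pair-complete : ∀ {c d} (p : c ⟂ d) → PhiElem (num (corner p) ∷ []) (dir c ∷ dir d ∷ [])
φ-pair-complete U⟂L = inj₁ refl
φ-pair-complete U⟂R = inj₁ refl
φ-pair-complete D⟂L = inj₁ refl
φ-pair-complete D⟂R = inj₂ refl
φ-pair-complete L⟂U = inj₂ refl
φ-pair-complete L⟂D = inj₂ refl
φ-pair-complete R⟂U = inj₂ refl
φ-pair-complete R⟂D = inj₁ refl

φ-pair-sound : ∀ {q y} → PhiElem (num q ∷ []) y →
               ∃₂ λ c d → Σ (c ⟂ d) λ p → y ≡ dir c ∷ dir d ∷ [] × corner p ≡ q
φ-pair-sound {q1} (inj₁ refl) = _ , _ , U⟂R , refl , refl
φ-pair-sound {q1} (inj₂ refl) = _ , _ , R⟂U , refl , refl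
φ-pair-sound {q2} (inj₁ refl) = _ , _ , U⟂L , refl , refl
φ-pair-sound {q2} (inj₂ refl) = _ , _ , L⟂U , refl , refl
φ-pair-sound {q3} (inj₁ refl) = _ , _ , D⟂L , refl , refl
φ-pair-sound {q3} (inj₂ refl) = _ , _ , L⟂D , refl , refl
φ-pair-sound {q4} (inj₁ refl) = _ , _ , R⟂D , refl , refl
φ-pair-sound {q4} (inj₂ refl) = _ , _ , D⟂R , refl , refl

φ-strict-sound : ∀ {q t x} → All IsDir t → PhiElem (num q ∷ t) x →
                 ∃₂ λ c d → Σ (c ⟂ d) λ p → x ≡ dir c ∷ dir d ∷ t × corner p ≡ q
φ-strict-sound [] x∈ = φ-pair-sound x∈
φ-strict-sound {q} {dir e ∷ t} (_ ∷ _) refl with turn-into q e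
... | c , d , p , d⟂e , refl = c , d , p , cong (λ ds → dirs ds ++ t) (varphi-corner p d⟂e) , refl

φ-strict-complete : ∀ {c d t} (p : c ⟂ d) → All IsDir t → Chain (dir d) t →
                    PhiElem (num (corner p) ∷ t) (dir c ∷ dir d ∷ t)
φ-strict-complete p [] _ = φ-pair-complete p
φ-strict-complete {t = dir e ∷ t} p (_ ∷ _) (d≁e , _) =
  cong (λ ds → dirs ds ++ t) (sym (varphi-corner p (orient≢⇒⟂ d≁e)))

lastQuadFrom-just : ∀ {m q} xs → m ≡ just q → ∃ λ q′ → lastQuadFrom m xs ≡ just q′
lastQuadFrom-just []                      m≡ = _ , m≡
lastQuadFrom-just             (num q ∷ xs) _ = lastQuadFrom-just xs refl
lastQuadFrom-just {just q}    (dir d ∷ xs) _ = lastQuadFrom-just xs refl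
lastQuadFrom-just {nothing}   (dir d ∷ xs) ()

lastQuadFrom-++ : ∀ m xs ys → lastQuadFrom m (xs ++ ys) ≡ lastQuadFrom (lastQuadFrom m xs) ys
lastQuadFrom-++ m        []           ys = refl
lastQuadFrom-++ m        (num q ∷ xs) ys = lastQuadFrom-++ (just q) xs ys
lastQuadFrom-++ (just q) (dir d ∷ xs) ys = lastQuadFrom-++ (just (stepQ d q)) xs ys
lastQuadFrom-++ nothing  (dir d ∷ xs) ys = lastQuadFrom-++ nothing xs ys

lastQuad-++ : ∀ pre v g → lastQuad (pre ++ v ++ g) ≡ lastQuadFrom (lastQuad (pre ++ v)) g
lastQuad-++ pre v g = trans (cong lastQuad (sym (++-assoc pre v g))) (lastQuadFrom-++ nothing (pre ++ v) g)

lastQuad-before-dir : ∀ xs {d ys} → PinWord (xs ++ dir d ∷ ys) → ∃ λ q → lastQuad xs ≡ just q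
lastQuad-before-dir (num q ∷ xs) _ = lastQuadFrom-just xs refl

Alternating : Word → Set
Alternating []       = ⊤
Alternating (x ∷ xs) = Chain x xs

PinWord⇒Alternating : ∀ w → PinWord w → Alternating w
PinWord⇒Alternating (num _ ∷ _) chain = chain

Alternating-∷⁻ : ∀ {x xs} → Alternating (x ∷ xs) → Alternating xs
Alternating-∷⁻ {xs = []}    _       = tt
Alternating-∷⁻ {xs = _ ∷ _} (_ , a) = a

Alternating-++⁻ʳ : ∀ xs {ys} → Alternating (xs ++ ys) → Alternating ys
Alternating-++⁻ʳ []       a = a
Alternating-++⁻ʳ (_ ∷ xs) a = Alternating-++⁻ʳ xs (Alternating-∷⁻ a)

Alternating-++⁻ˡ : ∀ xs {ys} → Alternating (xs ++ ys) → Alternating xs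
Alternating-++⁻ˡ []           _        = tt
Alternating-++⁻ˡ (_ ∷ [])     _        = tt
Alternating-++⁻ˡ (_ ∷ y ∷ xs) (ok , a) = ok , Alternating-++⁻ˡ (y ∷ xs) a

gap-block-alternating : ∀ pre v {wi rest} → PinWord (pre ++ v ++ wi ++ rest) → Alternating (v ++ wi)
gap-block-alternating pre v {wi} {rest} pw =
  Alternating-++⁻ˡ (v ++ wi)
    (subst Alternating (sym (++-assoc v wi rest))
      (Alternating-++⁻ʳ pre (PinWord⇒Alternating (pre ++ v ++ wi ++ rest) pw)))

BlockCondition : Set₁
BlockCondition = Word → Word → Word → Word → Set

ShiftInvariant : BlockCondition → Set
ShiftInvariant C = ∀ pre r {v u wi} → C (pre ++ r) v u wi → C pre (r ++ v) u wi

Split-shift : ∀ {C} → ShiftInvariant C → ∀ {pre r us w} →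
              Split C (pre ++ r) us w → Split C pre us (r ++ w)
Split-shift sh (end w) = end _
Split-shift {C} sh {pre} {r} (step {us = us} v wi rest refl c split) =
  step (r ++ v) wi rest (sym (++-assoc r v (wi ++ rest))) (sh pre r c)
    (subst (λ p → Split C p us rest) reassoc split)
  where
  reassoc : (pre ++ r) ++ v ++ wi ≡ pre ++ (r ++ v) ++ wi
  reassoc = solve (++-monoid Letter)

record Recut (C : BlockCondition) (pre v u wi : Word) : Set where
  constructor recut
  field
    gap block leftover : Word
    splits : v ++ wi ≡ gap ++ block ++ leftover
    holds  : C pre gap u block

RecutsInto : BlockCondition → BlockCondition → Set
RecutsInto C C′ = ∀ {pre v u wi rest} → PinWord (pre ++ v ++ wi ++ rest) → StrictShape u →
                  C pre v u wi → Recut C′ pre v u wi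

Split-recut : ∀ {C C′} → ShiftInvariant C′ → RecutsInto C C′ →
              ∀ {pre us w} → PinWord (pre ++ w) → All StrictShape us →
              Split C pre us w → Split C′ pre us w
Split-recut sh rc pw [] (end w) = end w
Split-recut {C} {C′} sh rc {pre} pw (su ∷ sus) (step {us = us} v wi rest refl c split)
  with rc pw su c
... | recut gap block leftover splits c′ =
  step gap block (leftover ++ rest) w-splits c′
    (Split-shift sh (subst (λ p → Split C′ p us rest) pre-splits (Split-recut sh rc pw′ sus split)))
  where
  open ≡-Reasoning
  pw′ : PinWord ((pre ++ v ++ wi) ++ rest)
  pw′ = subst PinWord reassoc pw
    where
    reassoc : pre ++ v ++ wi ++ rest ≡ (pre ++ v ++ wi) ++ rest
    reassoc = solve (++-monoid Letter)
  pre-splits : pre ++ v ++ wi ≡ (pre ++ gap ++ block) ++ leftover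
  pre-splits = begin
    pre ++ v ++ wi                      ≡⟨ cong (pre ++_) splits ⟩
    pre ++ gap ++ block ++ leftover     ≡⟨ solve (++-monoid Letter) ⟩
    (pre ++ gap ++ block) ++ leftover   ∎
  w-splits : v ++ wi ++ rest ≡ gap ++ block ++ leftover ++ rest
  w-splits = begin
    v ++ wi ++ rest                     ≡⟨ sym (++-assoc v wi rest) ⟩
    (v ++ wi) ++ rest                   ≡⟨ cong (_++ rest) splits ⟩
    (gap ++ block ++ leftover) ++ rest  ≡⟨ solve (++-monoid Letter) ⟩
    gap ++ block ++ leftover ++ rest    ∎

φ-inhabited : ∀ w → ∃ (PhiElem w)
φ-inhabited []              = _ , refl
φ-inhabited (num _ ∷ [])    = _ , inj₁ refl
φ-inhabited (num _ ∷ _ ∷ _) = _ , refl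
φ-inhabited (dir _ ∷ _)     = _ , refl

HasFactorIn-refl : ∀ w → HasFactorIn w w
HasFactorIn-refl w with φ-inhabited w
... | y , y∈ = y , y , y∈ , y∈ , [] , [] , sym (++-identityʳ y)

PhiCondition : Word → Word → Set
PhiCondition u wi = (SP wi ⊎ M wi) × HasFactorIn wi u

numeral-turn-PhiCondition : ∀ {q d t} → All IsDir t → Chain (num q) (dir d ∷ t) →
                            PhiCondition (num (stepQ d q) ∷ t) (num q ∷ dir d ∷ t)
numeral-turn-PhiCondition {q} {d} {t} t-dirs chain with turn-into q d
... | c , b , p , b⟂d , refl = inj₁ (chain , tt ∷ t-dirs) , _ , _ , refl , x∈ , [ dir c ] , [] , y≡
  where
  x∈ : PhiElem (num (stepQ d (corner p)) ∷ t) (dir b ∷ dir d ∷ t)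
  x∈ = subst (λ q → PhiElem (num q ∷ t) _) (sym (stepQ-corner p b⟂d))
         (φ-strict-complete b⟂d t-dirs (proj₂ chain))
  y≡ : dirs (varphi (corner p) d) ++ t ≡ [ dir c ] ++ (dir b ∷ dir d ∷ t) ++ []
  y≡ = trans (cong (λ ds → dirs ds ++ t) (varphi-corner p b⟂d))
             (cong (dir c ∷_) (sym (++-identityʳ _)))

direction-turn-PhiCondition : ∀ {c d t} (p : c ⟂ d) → All IsDir t → Chain (dir c) (dir d ∷ t) →
                              PhiCondition (num (corner p) ∷ t) (dir c ∷ dir d ∷ t)
direction-turn-PhiCondition p t-dirs chain =
  inj₂ (chain , tt ∷ t-dirs) , _ , _ , refl , φ-strict-complete p t-dirs (proj₂ chain) ,
  [] , [] , sym (++-identityʳ _)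

turn-PhiCondition : ∀ {d t q} m l → Alternating (l ∷ dir d ∷ t) → All IsDir t →
                    lastQuadFrom m (l ∷ dir d ∷ []) ≡ just q →
                    PhiCondition (num q ∷ t) (l ∷ dir d ∷ t)
turn-PhiCondition _ (num _) chain t-dirs refl = numeral-turn-PhiCondition t-dirs chain
turn-PhiCondition {d} {t} (just q₀) (dir c) chain t-dirs refl =
  subst (λ q → PhiCondition (num q ∷ t) (dir c ∷ dir d ∷ t)) (sym (stepQ∘stepQ-⟂ p q₀))
    (direction-turn-PhiCondition p t-dirs chain)
  where
  p : c ⟂ _
  p = orient≢⇒⟂ (proj₁ chain)

Cphi-shift : ShiftInvariant Cphi
Cphi-shift _ _ c = c

Cprec⇒Cphi : RecutsInto Cprec Cphi
Cprec⇒Cphi {pre} {v} pw t-dirs (inj₁ (_ , _ , refl , refl)) =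
  recut v _ [] (cong (v ++_) (sym (++-identityʳ _)))
    (inj₁ (Alternating-++⁻ʳ v (gap-block-alternating pre v pw) , t-dirs) , HasFactorIn-refl _)
Cprec⇒Cphi {pre} {v} pw t-dirs (inj₂ (d , t , q , _ , refl , refl , v≢[] , lq , refl)) with initLast v
... | [] = ⊥-elim (v≢[] refl)
... | v₀ ∷ʳ′ l =
  recut v₀ (l ∷ dir d ∷ t) [] splits (turn-PhiCondition (lastQuad (pre ++ v₀)) l chain t-dirs lq′)
  where
  open ≡-Reasoning
  splits : (v₀ ∷ʳ l) ++ dir d ∷ t ≡ v₀ ++ (l ∷ dir d ∷ t) ++ []
  splits = trans (∷ʳ-++ v₀ l _) (cong (v₀ ++_) (sym (++-identityʳ _)))
  chain : Alternating (l ∷ dir d ∷ t)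
  chain = Alternating-++⁻ʳ v₀
            (subst Alternating (∷ʳ-++ v₀ l _) (gap-block-alternating pre (v₀ ∷ʳ l) pw))
  lq′ : lastQuadFrom (lastQuad (pre ++ v₀)) (l ∷ dir d ∷ []) ≡ just q
  lq′ = begin
    lastQuadFrom (lastQuad (pre ++ v₀)) (l ∷ dir d ∷ [])  ≡⟨ sym (lastQuad-++ pre v₀ _) ⟩
    lastQuad (pre ++ v₀ ++ l ∷ dir d ∷ [])               ≡⟨ cong (λ g → lastQuad (pre ++ g))
                                                                 (sym (∷ʳ-++ v₀ l _)) ⟩
    lastQuad (pre ++ (v₀ ∷ʳ l) ++ [ dir d ])             ≡⟨ lq ⟩
    just q                                               ∎

∷ʳ≢[] : ∀ xs {x : Letter} → xs ∷ʳ x ≢ []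
∷ʳ≢[] []      ()
∷ʳ≢[] (_ ∷ _) ()

Cprec-shift : ShiftInvariant Cprec
Cprec-shift _ _ (inj₁ same) = inj₁ same
Cprec-shift pre r {v} (inj₂ (d , t , q , t′ , wi≡ , u≡ , v≢[] , lq , t≡t′)) =
  inj₂ (d , t , q , t′ , wi≡ , u≡ , (λ r++v≡[] → v≢[] (++-conicalʳ r v r++v≡[])) ,
        trans (cong lastQuad reassoc) lq , t≡t′)
  where
  reassoc : pre ++ (r ++ v) ++ [ dir d ] ≡ (pre ++ r) ++ v ++ [ dir d ]
  reassoc = solve (++-monoid Letter)

Cprec-direction-led : ∀ {pre gap d tl q} → gap ≢ [] → lastQuad (pre ++ gap) ≡ just q →
                      Cprec pre gap (num (stepQ d q) ∷ tl) (dir d ∷ tl)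
Cprec-direction-led {pre} {gap} {d} {q = q} gap≢[] lq =
  inj₂ (d , _ , _ , _ , refl , refl , gap≢[] , lq′ , refl)
  where
  lq′ : lastQuad (pre ++ gap ++ [ dir d ]) ≡ just (stepQ d q)
  lq′ = trans (lastQuad-++ pre gap [ dir d ]) (cong (λ m → lastQuadFrom m [ dir d ]) lq)

recut-at-turn : ∀ {pre v} K {c d tl b} (p : c ⟂ d) →
                (∃ λ q → lastQuadFrom (lastQuad (pre ++ v)) K ≡ just q) →
                Recut Cprec pre v (num (corner p) ∷ tl) (K ++ dir c ∷ dir d ∷ tl ++ b)
recut-at-turn {pre} {v} K {c} {d} {tl} {b} p (q , lq) =
  recut ((v ++ K) ∷ʳ dir c) (dir d ∷ tl) b splits
    (subst (λ q → Cprec pre _ (num q ∷ tl) _) (stepQ∘stepQ-⟂ p q)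
      (Cprec-direction-led {pre} (∷ʳ≢[] (v ++ K)) lq′))
  where
  open ≡-Reasoning
  splits : v ++ K ++ dir c ∷ dir d ∷ tl ++ b ≡ ((v ++ K) ∷ʳ dir c) ++ (dir d ∷ tl) ++ b
  splits = sym (trans (∷ʳ-++ (v ++ K) (dir c) _) (++-assoc v K _))
  lq′ : lastQuad (pre ++ (v ++ K) ∷ʳ dir c) ≡ just (stepQ c q)
  lq′ = begin
    lastQuad (pre ++ (v ++ K) ++ [ dir c ])
      ≡⟨ lastQuad-++ pre (v ++ K) [ dir c ] ⟩
    lastQuadFrom (lastQuad (pre ++ v ++ K)) [ dir c ]
      ≡⟨ cong (λ m → lastQuadFrom m [ dir c ]) (lastQuad-++ pre v K) ⟩
    lastQuadFrom (lastQuadFrom (lastQuad (pre ++ v)) K) [ dir c ]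
      ≡⟨ cong (λ m → lastQuadFrom m [ dir c ]) lq ⟩
    just (stepQ c q)
      ∎

recut-direction-led : ∀ {pre v wi rest c d tl} a {b} (p : c ⟂ d) →
                      PinWord (pre ++ v ++ wi ++ rest) → M wi → wi ≡ a ++ dir c ∷ dir d ∷ tl ++ b →
                      Recut Cprec pre v (num (corner p) ∷ tl) wi
recut-direction-led {pre} {v} {dir e ∷ ws} {rest} a p pw _ wi≡
  with lastQuad-before-dir (pre ++ v) (subst PinWord (sym (++-assoc pre v (dir e ∷ ws ++ rest))) pw)
... | _ , lq = subst (Recut Cprec pre v _) (sym wi≡) (recut-at-turn a p (lastQuadFrom-just a lq))

-- φ(q t) = c′ d′ t, and the occurrence of φ(u) = c d tl starts at c′, at d′ or inside t.
recut-numeral-led : ∀ {pre v q t y c d tl} a {b} (p : c ⟂ d) →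
                    All IsDir t → PhiElem (num q ∷ t) y → y ≡ a ++ dir c ∷ dir d ∷ tl ++ b →
                    Recut Cprec pre v (num (corner p) ∷ tl) (num q ∷ t)
recut-numeral-led a p t-dirs y∈ y≡ with φ-strict-sound t-dirs y∈
recut-numeral-led {v = v} {tl = tl} [] {b} p _ _ refl | _ , _ , p′ , refl , refl with ⟂-irrelevant p p′
... | refl = recut v (num (corner p) ∷ tl) b refl (inj₁ (_ , _ , refl , refl))
recut-numeral-led {pre} {v} {tl = tl} (_ ∷ []) {b} p _ _ refl | _ , _ , p′ , refl , refl =
  recut (v ∷ʳ num (corner p′)) (dir _ ∷ tl) b (sym (∷ʳ-++ v _ _))
    (subst (λ q → Cprec pre _ (num q ∷ tl) _) (stepQ-corner p′ p)
      (Cprec-direction-led {pre} (∷ʳ≢[] v) (lastQuad-++ pre v [ num (corner p′) ])))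
recut-numeral-led (_ ∷ _ ∷ a) p _ _ refl | _ , _ , p′ , refl , refl =
  recut-at-turn (num _ ∷ a) p (lastQuadFrom-just a refl)

Cphi⇒Cprec : RecutsInto Cphi Cprec
Cphi⇒Cprec {u = num _ ∷ _} _ tl-dirs (_ , _ , _ , _ , x∈ , _) with φ-strict-sound tl-dirs x∈
Cphi⇒Cprec {wi = num _ ∷ _} _ _ (inj₁ (_ , t-dirs) , _ , _ , y∈ , _ , a , _ , y≡)
  | _ , _ , p , refl , refl =
  recut-numeral-led a p t-dirs y∈ y≡
Cphi⇒Cprec {wi = dir _ ∷ _} pw _ (inj₂ m , _ , _ , y∈ , _ , a , _ , y≡)
  | _ , _ , p , refl , refl =
  recut-direction-led a p pw m (trans (sym y∈) y≡)

NoLeadingDir : Word → Set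
NoLeadingDir (dir _ ∷ _) = ⊥
NoLeadingDir _           = ⊤

concat-noLeadingDir : ∀ {xs} → All StrictShape xs → NoLeadingDir (concat xs)
concat-noLeadingDir []                      = tt
concat-noLeadingDir (_∷_ {num _ ∷ _} _ _) = tt

dirs-++-unique : ∀ {ts ts′ A B} → All IsDir ts → All IsDir ts′ →
                 NoLeadingDir A → NoLeadingDir B → ts ++ A ≡ ts′ ++ B → ts ≡ ts′ × A ≡ B
dirs-++-unique []                  []                  _  _  A≡B  = refl , A≡B
dirs-++-unique []                  (_∷_ {dir _} _ _) () _  refl
dirs-++-unique (_∷_ {dir _} _ _) []                  _  () refl
dirs-++-unique (_ ∷ ds)            (_ ∷ ds′)           nA nB eq with ∷-injective eq
... | refl , eq′ with dirs-++-unique ds ds′ nA nB eq′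
... | refl , A≡B = refl , A≡B

strongDecomp-unique : ∀ {xs ys} → All StrictShape xs → All StrictShape ys →
                      concat xs ≡ concat ys → xs ≡ ys
strongDecomp-unique []                          []                          _  = refl
strongDecomp-unique []                          (_∷_ {num _ ∷ _} _ _)     ()
strongDecomp-unique (_∷_ {num _ ∷ _} _ _)     []                          ()
strongDecomp-unique (_∷_ {num _ ∷ _} ds sxs) (_∷_ {num _ ∷ _} ds′ sys) eq with ∷-injective eq
... | refl , eq′ with dirs-++-unique ds ds′ (concat-noLeadingDir sxs) (concat-noLeadingDir sys) eq′
... | refl , eq″ = cong (_ ∷_) (strongDecomp-unique sxs sys eq″)

theorem3p13 : (u w : Word) → PinWord u → PinWord w →
    (us : List Word) → StrongDecomp u us →
    (u ≼ w) ⇔ Split Cphi [] us w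
theorem3p13 u w _ pw us (concat≡u , strict) = mk⇔ to from
  where
  to : u ≼ w → Split Cphi [] us w
  to (us′ , (concat≡u′ , strict′) , split) =
    Split-recut Cphi-shift Cprec⇒Cphi pw strict
      (subst (λ vs → Split Cprec [] vs w) us′≡us split)
    where
    us′≡us : us′ ≡ us
    us′≡us = strongDecomp-unique strict′ strict (trans concat≡u′ (sym concat≡u))
  from : Split Cphi [] us w → u ≼ w
  from split = us , (concat≡u , strict) , Split-recut Cprec-shift Cphi⇒Cprec pw strict split
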